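{- Let $g\ge 4$ and $k$ be integers with $k>\lceil g/2\rceil$. Then every transversal design {\rm TD}$(k+2,g)$ is group-equitably $2$-colourable.
   Context: A transversal design {\rm TD}$(n,g)$ consists of $ng$ points partitioned into $n$ groups of size $g$ and a collection of $n$-subsets (blocks) such that every pair of points from distinct groups lies in exactly one block and no pair from the same group lies in a block. A weak $c$-colouring is a map from the points to $c$ colours such that no block is monochromatic. A weak $c$-colouring of a GDD is group-equitable if each group of size $g$ contains either $\lfloor g/c\rfloor$ or $\lceil g/c\rceil$ points of each colour; a design is group-equitably $c$-colourable if it admits such a colouring. -}

module Defs where

open import Data.Nat using (ℕ; suc; _+_; _∸_; _/_; NonZero; _≡ᵇ_)
open import Data.Fin using (Fin)
open import Data.Fin.Properties using (_≟_)
open import Data.Product using (_×_; _,_; proj₁; ∃; ∃₂; Σ)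
open import Data.Product.Properties using (≡-dec)
open import Data.Sum using (_⊎_)
open import Data.List using (List; length; filter; allFin)
open import Data.List.Relation.Unary.All using (All)
open import Data.List.Relation.Unary.Unique.Propositional using (Unique)
open import Data.List.Membership.Propositional using (_∈_)
import Data.List.Membership.DecPropositional as DecMem
open import Relation.Binary.PropositionalEquality using (_≡_; _≢_)
open import Relation.Nullary using (¬_)
open import Relation.Nullary.Decidable using (_×-dec_)

Point : ℕ → ℕ → Set
Point n g = Fin n × Fin g

group : ∀ {n g} → Point n g → Fin n
group = proj₁

_≟P_ : ∀ {n g} (x y : Point n g) → Relation.Nullary.Dec (x ≡ y)
_≟P_ = ≡-dec _≟_ _≟_

module _ {n g : ℕ} where
  open DecMem (_≟P_ {n} {g}) using (_∈?_)

  countBlocksWith : List (List (Point n g)) → Point n g → Point n g → ℕ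
  countBlocksWith Bs x y = length (filter (λ B → (x ∈? B) ×-dec (y ∈? B)) Bs)

-- A transversal design TD(n,g) on the point set Point n g, with the
-- groups {i} × Fin g.  A block is a duplicate-free list (i.e. a set) of points.
record TD (n g : ℕ) : Set where
  field
    blocks      : List (List (Point n g))
    block-size  : All (λ B → Unique B × length B ≡ n) blocks
    no-same     : All (λ B → ∀ x y → x ∈ B → y ∈ B → x ≢ y → group x ≢ group y) blocks
    pair-once   : ∀ (x y : Point n g) → group x ≢ group y → countBlocksWith blocks x y ≡ 1
open TD public

WeakColouring : ∀ {n g} (c : ℕ) → TD n g → (Point n g → Fin c) → Set
WeakColouring c D col =
  All (λ B → ¬ (∃ λ a → All (λ x → col x ≡ a) B)) (blocks D)

colourCount : ∀ {n g c} → (Point n g → Fin c) → Fin n → Fin c → ℕ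
colourCount {g = g} col i a = length (filter (λ j → col (i , j) ≟ a) (allFin g))

-- group-equitable: each group has ⌊g/c⌋ or ⌈g/c⌉ points of each colour
GroupEquitable : ∀ {n g} (c : ℕ) .{{_ : NonZero c}} → (Point n g → Fin c) → Set
GroupEquitable {n} {g} c col =
  ∀ (i : Fin n) (a : Fin c) →
    (colourCount col i a ≡ g / c) ⊎ (colourCount col i a ≡ (g + c ∸ 1) / c)

GroupEquitablyColourable : ∀ {n g} (c : ℕ) .{{_ : NonZero c}} → TD n g → Set
GroupEquitablyColourable c D =
  ∃ λ col → WeakColouring c D col × GroupEquitable c col

-- Fix x₀ = (0,0) and use group 1 as a reference group.  Colour group 0 by the
-- parity of the index, group 1 by the opposite parity, and a point p of any
-- other group by the parity of the trace of p, the point where the block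
-- through x₀ and p meets group 1.  On each group the trace is a bijection onto
-- group 1, so every group receives ⌈g/2⌉ and ⌊g/2⌋ points of the two colours.
-- A block through x₀ contains a point p of group 2 and the trace of p, which
-- get opposite colours.  A block B missing x₀ meets the k > ⌈g/2⌉ groups
-- 2, …, k+1 in points with pairwise distinct traces (two of them with equal
-- traces would lie on one block with x₀, which would then be B); as a parity
-- class of group 1 has at most ⌈g/2⌉ elements, B is not monochromatic.
module Submission where

open import Defs
open import Data.Nat using (ℕ; zero; suc; _≤_; _<_; _+_; _∸_; _/_; ⌊_/2⌋; ⌈_/2⌉; s≤s; z≤n)
import Data.Nat.Properties as ℕ
open import Data.Nat.DivMod using (m/n≡1+[m∸n]/n; /-congˡ)
open import Algebra.Properties.CommutativeSemigroup ℕ.+-commutativeSemigroup using (x∙yz≈y∙xz)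
open import Data.Fin using (Fin; zero; suc; toℕ; punchIn; punchOut; fromℕ<)
  renaming (_≟_ to _≟ᶠ_; _<_ to _<ᶠ_)
import Data.Fin.Properties as Fin
open import Data.Bool using (Bool; true; false; if_then_else_)
open import Data.Product using (_×_; _,_; proj₁; proj₂; ∃; ∃₂)
open import Data.Sum using (_⊎_; inj₁; inj₂)
open import Data.Empty using (⊥-elim)
open import Data.List using (List; []; _∷_; length; filter; tabulate; lookup)
open import Data.List.Relation.Unary.All as All using (All)
open import Data.List.Relation.Unary.All.Properties.Core using (¬Any⇒All¬)
open import Data.List.Relation.Unary.Any using (here; any?)
open import Data.List.Relation.Unary.AllPairs using (_∷_)
open import Data.List.Relation.Unary.Unique.Propositional using (Unique)
open import Data.List.Membership.Propositional using (_∈_; _∉_; find)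
open import Data.List.Membership.Propositional.Properties using (∈-filter⁺; ∈-filter⁻; ∈-lookup)
import Data.List.Membership.DecPropositional as DecMembership
open import Function using (_∘_)
open import Function.Definitions using (Injective)
open import Relation.Binary.PropositionalEquality
  using (_≡_; _≢_; refl; sym; trans; cong; cong₂; subst; module ≡-Reasoning)
open import Relation.Nullary using (¬_; yes; no; does)
open import Relation.Nullary.Decidable using (_×-dec_)
open import Relation.Unary using (Pred; Decidable)

indicator : Bool → ℕ
indicator b = if b then 1 else 0

count : ∀ n → (Fin n → Bool) → ℕ
count zero    b = 0
count (suc n) b = indicator (b zero) + count n (b ∘ suc)

count-cong : ∀ n {b b′ : Fin n → Bool} → (∀ j → b j ≡ b′ j) → count n b ≡ count n b′
count-cong zero    eq = refl
count-cong (suc n) eq = cong₂ _+_ (cong indicator (eq zero)) (count-cong n (eq ∘ suc))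

count-punchIn : ∀ n (t : Fin (suc n)) (b : Fin (suc n) → Bool) →
                count (suc n) b ≡ indicator (b t) + count n (b ∘ punchIn t)
count-punchIn n       zero    b = refl
count-punchIn (suc n) (suc t) b =
  trans (cong (indicator (b zero) +_) (count-punchIn n t (b ∘ suc)))
        (x∙yz≈y∙xz (indicator (b zero)) (indicator (b (suc t))) _)

count-reindex : ∀ n {φ : Fin n → Fin n} → Injective _≡_ _≡_ φ →
                ∀ b → count n (b ∘ φ) ≡ count n b
count-reindex zero    inj b = refl
count-reindex (suc n) {φ} inj b = begin
  indicator (b t) + count n (b ∘ φ ∘ suc)          ≡⟨ cong (indicator (b t) +_) reindex-rest ⟩
  indicator (b t) + count n (b ∘ punchIn t)        ≡⟨ sym (count-punchIn n t b) ⟩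
  count (suc n) b                                  ∎
  where
  open ≡-Reasoning
  t = φ zero
  t≢φsuc : ∀ j → t ≢ φ (suc j)
  t≢φsuc j eq with inj eq
  ... | ()
  φ′ : Fin n → Fin n
  φ′ j = punchOut (t≢φsuc j)
  φ′-injective : Injective _≡_ _≡_ φ′
  φ′-injective eq = Fin.suc-injective (inj (Fin.punchOut-injective (t≢φsuc _) (t≢φsuc _) eq))
  reindex-rest : count n (b ∘ φ ∘ suc) ≡ count n (b ∘ punchIn t)
  reindex-rest = trans (count-cong n (λ j → cong b (sym (Fin.punchIn-punchOut (t≢φsuc j)))))
                       (count-reindex n φ′-injective (b ∘ punchIn t))

length-filter-tabulate : ∀ {A : Set} {p} {P : Pred A p} (P? : Decidable P) n (f : Fin n → A) →
                         length (filter P? (tabulate f)) ≡ count n (λ j → does (P? (f j)))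
length-filter-tabulate P? zero    f = refl
length-filter-tabulate P? (suc n) f with does (P? (f zero))
... | true  = cong suc (length-filter-tabulate P? n (f ∘ suc))
... | false = length-filter-tabulate P? n (f ∘ suc)

other : Fin 2 → Fin 2
other zero       = suc zero
other (suc zero) = zero

other-involutive : ∀ u → other (other u) ≡ u
other-involutive zero       = refl
other-involutive (suc zero) = refl

other-≢ : ∀ u → other u ≢ u
other-≢ zero       ()
other-≢ (suc zero) ()

does-other-≟ : ∀ u a → does (other u ≟ᶠ a) ≡ does (u ≟ᶠ other a)
does-other-≟ zero       zero       = refl
does-other-≟ zero       (suc zero) = refl
does-other-≟ (suc zero) zero       = refl
does-other-≟ (suc zero) (suc zero) = refl

parity : ℕ → Fin 2
parity zero    = zero
parity (suc m) = other (parity m)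

parityCount : ∀ n → Fin 2 → ℕ
parityCount n a = count n (λ j → does (parity (toℕ j) ≟ᶠ a))

parityCount-even : ∀ n → parityCount n zero ≡ ⌈ n /2⌉
parityCount-odd  : ∀ n → parityCount n (suc zero) ≡ ⌊ n /2⌋
parityCount-even zero    = refl
parityCount-even (suc n) =
  cong suc (trans (count-cong n (λ j → does-other-≟ (parity (toℕ j)) zero)) (parityCount-odd n))
parityCount-odd zero    = refl
parityCount-odd (suc n) =
  trans (count-cong n (λ j → does-other-≟ (parity (toℕ j)) (suc zero))) (parityCount-even n)

⌊n/2⌋≡n/2 : ∀ n → ⌊ n /2⌋ ≡ n / 2
⌊n/2⌋≡n/2 zero          = refl
⌊n/2⌋≡n/2 (suc zero)    = refl
⌊n/2⌋≡n/2 (suc (suc n)) =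
  trans (cong suc (⌊n/2⌋≡n/2 n)) (sym (m/n≡1+[m∸n]/n {suc (suc n)} {2} (s≤s (s≤s z≤n))))

⌈n/2⌉≡[n+2∸1]/2 : ∀ n → ⌈ n /2⌉ ≡ (n + 2 ∸ 1) / 2
⌈n/2⌉≡[n+2∸1]/2 n =
  trans (⌊n/2⌋≡n/2 (suc n)) (/-congˡ (trans (ℕ.+-comm 1 n) (sym (ℕ.+-∸-assoc n {2} {1} (s≤s z≤n)))))

parityCount-balanced : ∀ n a → parityCount n a ≡ n / 2 ⊎ parityCount n a ≡ (n + 2 ∸ 1) / 2
parityCount-balanced n zero       = inj₂ (trans (parityCount-even n) (⌈n/2⌉≡[n+2∸1]/2 n))
parityCount-balanced n (suc zero) = inj₁ (trans (parityCount-odd n) (⌊n/2⌋≡n/2 n))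

parity-⌊/2⌋-injective : ∀ a b → parity a ≡ parity b → ⌊ a /2⌋ ≡ ⌊ b /2⌋ → a ≡ b
parity-⌊/2⌋-injective zero          zero          _  _  = refl
parity-⌊/2⌋-injective zero          (suc zero)    () _
parity-⌊/2⌋-injective (suc zero)    zero          () _
parity-⌊/2⌋-injective (suc zero)    (suc zero)    _  _  = refl
parity-⌊/2⌋-injective (suc (suc a)) (suc (suc b)) p  h =
  cong (λ c → suc (suc c)) (parity-⌊/2⌋-injective a b
    (trans (sym (other-involutive (parity a))) (trans p (other-involutive (parity b))))
    (ℕ.suc-injective h))

sameParity-pigeonhole : ∀ {m n} → ⌈ n /2⌉ < m → (c : Fin m → Fin n) →
                        (∀ r s → parity (toℕ (c r)) ≡ parity (toℕ (c s))) →
                        ∃₂ λ r s → r <ᶠ s × c r ≡ c s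
sameParity-pigeonhole {m} {n} ⌈n/2⌉<m c sameParity =
  let (r , s , r<s , hr≡hs) = Fin.pigeonhole ⌈n/2⌉<m half
  in r , s , r<s , Fin.toℕ-injective (parity-⌊/2⌋-injective _ _ (sameParity r s) (half-≡ hr≡hs))
  where
  half< : ∀ r → ⌊ toℕ (c r) /2⌋ < ⌈ n /2⌉
  half< r = ℕ.⌈n/2⌉-mono (Fin.toℕ<n (c r))
  half : Fin m → Fin ⌈ n /2⌉
  half r = fromℕ< (half< r)
  half-≡ : ∀ {r s} → half r ≡ half s → ⌊ toℕ (c r) /2⌋ ≡ ⌊ toℕ (c s) /2⌋
  half-≡ {r} {s} eq = trans (sym (Fin.toℕ-fromℕ< (half< r))) (trans (cong toℕ eq) (Fin.toℕ-fromℕ< (half< s)))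

Unique-lookup : ∀ {A : Set} {xs : List A} → Unique xs →
                ∀ {i j : Fin (length xs)} → i <ᶠ j → lookup xs i ≢ lookup xs j
Unique-lookup (x∉xs ∷ _)  {zero}  {suc j} _         = All.lookup x∉xs (∈-lookup j)
Unique-lookup (_ ∷ uniq) {suc i} {suc j} (s≤s i<j) = Unique-lookup uniq i<j

length-one-∃ : ∀ {A : Set} {xs : List A} → length xs ≡ 1 → ∃ (_∈ xs)
length-one-∃ {xs = x ∷ []} _ = x , here refl

length-one-∈ : ∀ {A : Set} {xs : List A} → length xs ≡ 1 → ∀ {a b} → a ∈ xs → b ∈ xs → a ≡ b
length-one-∈ {xs = _ ∷ []} _ (here refl) (here refl) = refl

module TDProperties {n g} (D : TD (suc n) g) where

  Pt : Set
  Pt = Point (suc n) g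
  open DecMembership (_≟P_ {suc n} {g}) using (_∈?_)

  on-both : (u v : Pt) → Decidable (λ B → u ∈ B × v ∈ B)
  on-both u v B = (u ∈? B) ×-dec (v ∈? B)

  block-unique : ∀ {u v} → group u ≢ group v → ∀ {B B′} → B ∈ blocks D → B′ ∈ blocks D →
                 u ∈ B → v ∈ B → u ∈ B′ → v ∈ B′ → B ≡ B′
  block-unique {u} {v} u≁v B∈ B′∈ u∈B v∈B u∈B′ v∈B′ =
    length-one-∈ (pair-once D u v u≁v)
      (∈-filter⁺ (on-both u v) B∈ (u∈B , v∈B)) (∈-filter⁺ (on-both u v) B′∈ (u∈B′ , v∈B′))

  same-group-≡ : ∀ {B} → B ∈ blocks D → ∀ {u v} → u ∈ B → v ∈ B → group u ≡ group v → u ≡ v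
  same-group-≡ B∈ {u} {v} u∈B v∈B u∼v with u ≟P v
  ... | yes u≡v = u≡v
  ... | no  u≢v = ⊥-elim (All.lookup (no-same D) B∈ u v u∈B v∈B u≢v u∼v)

  block-avoids-no-group : ∀ {B} → B ∈ blocks D → ∀ i → ¬ All (λ p → group p ≢ i) B
  block-avoids-no-group {B} B∈ i avoid =
    let (s , t , s<t , squeeze≡) = Fin.pigeonhole n<|B| squeeze
    in Unique-lookup uniq s<t
         (same-group-≡ B∈ (∈-lookup s) (∈-lookup t)
           (Fin.punchOut-injective (i≢group s) (i≢group t) squeeze≡))
    where
    uniq : Unique B
    uniq = proj₁ (All.lookup (block-size D) B∈)
    n<|B| : n < length B
    n<|B| = ℕ.≤-reflexive (sym (proj₂ (All.lookup (block-size D) B∈)))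
    i≢group : ∀ t → i ≢ group (lookup B t)
    i≢group t eq = All.lookup avoid (∈-lookup t) (sym eq)
    squeeze : Fin (length B) → Fin n
    squeeze t = punchOut (i≢group t)

  block-meets-group : ∀ {B} → B ∈ blocks D → ∀ i → ∃ λ j → (i , j) ∈ B
  block-meets-group {B} B∈ i with any? (λ p → group p ≟ᶠ i) B
  ... | no  miss = ⊥-elim (block-avoids-no-group B∈ i (¬Any⇒All¬ B miss))
  ... | yes hit with find hit
  ...   | (_ , j) , p∈B , refl = j , p∈B

  blockThrough : ∀ u v → group u ≢ group v → ∃ λ B → B ∈ blocks D × u ∈ B × v ∈ B
  blockThrough u v u≁v =
    let (B , B∈) = length-one-∃ (pair-once D u v u≁v)
    in B , ∈-filter⁻ (on-both u v) B∈

module TwoColouring {m g} (D : TD (2 + m) (suc g)) where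

  open TDProperties D

  x₀ : Pt
  x₀ = zero , zero

  outer : Fin m → Fin (suc g) → Pt
  outer r j = suc (suc r) , j

  x₀-line : ∀ r j → ∃ λ L → L ∈ blocks D × x₀ ∈ L × outer r j ∈ L
  x₀-line r j = blockThrough x₀ (outer r j) (λ ())

  trace : Fin m → Fin (suc g) → Fin (suc g)
  trace r j = proj₁ (block-meets-group (proj₁ (proj₂ (x₀-line r j))) (suc zero))

  trace-∈-x₀-line : ∀ r j → (suc zero , trace r j) ∈ proj₁ (x₀-line r j)
  trace-∈-x₀-line r j = proj₂ (block-meets-group (proj₁ (proj₂ (x₀-line r j))) (suc zero))

  x₀-line-unique : ∀ {r j B} → B ∈ blocks D → x₀ ∈ B → outer r j ∈ B → proj₁ (x₀-line r j) ≡ B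
  x₀-line-unique {r} {j} B∈ x₀∈B p∈B =
    let (_ , L∈ , x₀∈L , p∈L) = x₀-line r j in block-unique (λ ()) L∈ B∈ x₀∈L p∈L x₀∈B p∈B

  trace-∈ : ∀ {r j B} → B ∈ blocks D → x₀ ∈ B → outer r j ∈ B → (suc zero , trace r j) ∈ B
  trace-∈ {r} {j} B∈ x₀∈B p∈B = subst (_ ∈_) (x₀-line-unique B∈ x₀∈B p∈B) (trace-∈-x₀-line r j)

  equal-traces-collinear : ∀ {r i s j} → trace r i ≡ trace s j → outer s j ∈ proj₁ (x₀-line r i)
  equal-traces-collinear {r} {i} {s} {j} eq =
    let (_ , L∈ , x₀∈L , _) = x₀-line r i
        (_ , L′∈ , x₀∈L′ , q∈L′) = x₀-line s j
        c∈L′ = subst (λ c → (suc zero , c) ∈ proj₁ (x₀-line s j)) (sym eq) (trace-∈-x₀-line s j)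
    in subst (_ ∈_) (block-unique (λ ()) L′∈ L∈ x₀∈L′ c∈L′ x₀∈L (trace-∈-x₀-line r i)) q∈L′

  trace-injective : ∀ r → Injective _≡_ _≡_ (trace r)
  trace-injective r {i} {j} eq =
    let (_ , L∈ , _ , p∈L) = x₀-line r i
    in cong proj₂ (same-group-≡ L∈ p∈L (equal-traces-collinear eq) refl)

  traces-distinct-off-x₀ : ∀ {B} → B ∈ blocks D → x₀ ∉ B → ∀ {r i s j} → r ≢ s →
                           outer r i ∈ B → outer s j ∈ B → trace r i ≢ trace s j
  traces-distinct-off-x₀ B∈ x₀∉B {r} {i} r≢s p∈B q∈B eq =
    let (_ , L∈ , x₀∈L , p∈L) = x₀-line r i
        q∈L = equal-traces-collinear eq
    in x₀∉B (subst (x₀ ∈_) (block-unique (r≢s ∘ Fin.suc-injective ∘ Fin.suc-injective) L∈ B∈ p∈L q∈L p∈B q∈B) x₀∈L)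

  colour : Pt → Fin 2
  colour (zero , j)        = parity (toℕ j)
  colour (suc zero , j)    = other (parity (toℕ j))
  colour (suc (suc r) , j) = parity (toℕ (trace r j))

  colourCount-parityCount : ∀ i a → ∃ λ a′ → colourCount colour i a ≡ parityCount (suc g) a′
  colourCount-parityCount zero a =
    a , length-filter-tabulate (λ j → colour (zero , j) ≟ᶠ a) (suc g) (λ j → j)
  colourCount-parityCount (suc zero) a =
    other a , trans (length-filter-tabulate (λ j → colour (suc zero , j) ≟ᶠ a) (suc g) (λ j → j))
                    (count-cong (suc g) (λ j → does-other-≟ (parity (toℕ j)) a))
  colourCount-parityCount (suc (suc r)) a =
    a , trans (length-filter-tabulate (λ j → colour (suc (suc r) , j) ≟ᶠ a) (suc g) (λ j → j))
              (count-reindex (suc g) (trace-injective r) (λ c → does (parity (toℕ c) ≟ᶠ a)))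

  colour-groupEquitable : GroupEquitable 2 colour
  colour-groupEquitable i a with colourCount-parityCount i a
  ... | a′ , eq with parityCount-balanced (suc g) a′
  ...   | inj₁ ⌊⌋ = inj₁ (trans eq ⌊⌋)
  ...   | inj₂ ⌈⌉ = inj₂ (trans eq ⌈⌉)

  Monochromatic : List Pt → Set
  Monochromatic B = ∃ λ a → All (λ p → colour p ≡ a) B

  x₀-block-bichromatic : Fin m → ∀ {B} → B ∈ blocks D → x₀ ∈ B → ¬ Monochromatic B
  x₀-block-bichromatic r B∈ x₀∈B (a , mono) =
    let (j , p∈B) = block-meets-group B∈ (suc (suc r))
    in other-≢ _ (trans (All.lookup mono (trace-∈ B∈ x₀∈B p∈B)) (sym (All.lookup mono p∈B)))

  off-x₀-block-bichromatic : ⌈ suc g /2⌉ < m → ∀ {B} → B ∈ blocks D → x₀ ∉ B → ¬ Monochromatic B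
  off-x₀-block-bichromatic ⌈g/2⌉<m {B} B∈ x₀∉B (a , mono) =
    let (r , s , r<s , c≡) = sameParity-pigeonhole ⌈g/2⌉<m c sameParity
    in traces-distinct-off-x₀ B∈ x₀∉B (Fin.<⇒≢ r<s) (p∈B r) (p∈B s) c≡
    where
    j : Fin m → Fin (suc g)
    j r = proj₁ (block-meets-group B∈ (suc (suc r)))
    p∈B : ∀ r → outer r (j r) ∈ B
    p∈B r = proj₂ (block-meets-group B∈ (suc (suc r)))
    c : Fin m → Fin (suc g)
    c r = trace r (j r)
    sameParity : ∀ r s → parity (toℕ (c r)) ≡ parity (toℕ (c s))
    sameParity r s = trans (All.lookup mono (p∈B r)) (sym (All.lookup mono (p∈B s)))

  groupEquitablyColourable : ⌈ suc g /2⌉ < m → GroupEquitablyColourable 2 D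
  groupEquitablyColourable ⌈g/2⌉<m = colour , All.tabulate bichromatic , colour-groupEquitable
    where
    open DecMembership (_≟P_ {2 + m} {suc g}) using (_∈?_)
    bichromatic : ∀ {B} → B ∈ blocks D → ¬ Monochromatic B
    bichromatic {B} B∈ with x₀ ∈? B
    ... | yes x₀∈B = x₀-block-bichromatic (fromℕ< (ℕ.≤-trans (s≤s z≤n) ⌈g/2⌉<m)) B∈ x₀∈B
    ... | no  x₀∉B = off-x₀-block-bichromatic ⌈g/2⌉<m B∈ x₀∉B

theorem4p2 : ∀ (g k : ℕ) → 4 ≤ g → ⌈ g /2⌉ < k →
    (D : TD (k + 2) g) → GroupEquitablyColourable 2 D
theorem4p2 (suc g) k _ ⌈g/2⌉<k =
  subst (λ n → (D : TD n (suc g)) → GroupEquitablyColourable 2 D) (ℕ.+-comm 2 k)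
        (λ D → TwoColouring.groupEquitablyColourable D ⌈g/2⌉<k)
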